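{- Let $H=(V,E)$ be a hypergraph, $w\in \mathbb{R}_{\geq 0}^E$, $b\in \mathbb{Z}^V_{\geq 1}$, and let $x\in[0,1]^E$ be a fractional $b$-matching. Then the greedy algorithm (which orders the edges as $e_1,\dots,e_m$ with $w(e_1)\ge w(e_2)\ge\cdots\ge w(e_m)$, starts with $M=\emptyset$, and for $j=1,\dots,m$ adds $e_j$ to $M$ whenever $M\cup\{e_j\}$ is a $b$-matching) returns a $b$-matching $M$ satisfying \[ \sum_{e\in M}\bigl(|e|-(|e|-1)x(e)\bigr)w(e) \;\geq\; \sum_{e\in E} w(e)x(e). \]
   Context: A hypergraph $H=(V,E)$ has a finite vertex set $V$ and edge set $E\subseteq 2^V$. For $v\in V$, $\delta(v)=\{e\in E: v\in e\}$, and for $x\in\mathbb{R}^E$ and $U\subseteq E$, $x(U)=\sum_{e\in U}x(e)$. Given vertex capacities $b\in\mathbb{Z}^V_{\ge 1}$, a $b$-matching is a set $M\subseteq E$ such that each $v\in V$ is contained in at most $b(v)$ edges of $M$. A fractional $b$-matching is a vector $x\in[0,1]^E$ with $x(\delta(v))\le b(v)$ for all $v\in V$. Ties in the weight ordering may be broken arbitrarily. -}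

module Defs where

open import Level using (Level; _⊔_) renaming (suc to lsuc)
open import Data.Bool using (Bool; true; false; if_then_else_)
open import Data.Nat as ℕ using (ℕ; _∸_)
import Data.Nat.Properties as ℕP
open import Data.Fin as Fin using (Fin)
open import Data.Fin.Subset using (Subset; _∈_; _∪_; ⁅_⁆; ∣_∣) renaming (⊥ to ∅)
open import Data.Fin.Subset.Properties using (_∈?_)
open import Data.Fin.Properties using (all?)
open import Data.List using (List; foldl) renaming (map to mapL)
open import Data.Nat.ListAction using () renaming (sum to sumℕ)
open import Data.Product using (_×_)
open import Data.List using () renaming (allFin to allFinL)
open import Data.Vec using (lookup)
open import Relation.Binary using (Rel; IsTotalOrder)
open import Relation.Nullary using (does)
open import Function.Definitions using (Injective)
open import Relation.Binary.PropositionalEquality using (_≡_)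
open import Algebra.Bundles using (CommutativeRing)
open import Algebra.Definitions.RawMonoid using ()
import Algebra.Properties.Monoid.Sum as MonoidSum

-- Ordered commutative rings (ℝ with its usual order is an instance).

record OrderedCommRing (c ℓ₁ ℓ₂ : Level) : Set (lsuc (c ⊔ ℓ₁ ⊔ ℓ₂)) where
  field
    commutativeRing : CommutativeRing c ℓ₁
  open CommutativeRing commutativeRing public
  infix 4 _≤_
  field
    _≤_          : Rel Carrier ℓ₂
    isTotalOrder : IsTotalOrder _≈_ _≤_
    +-mono-≤     : ∀ {x y} z → x ≤ y → (x + z) ≤ (y + z)
    *-nonneg     : ∀ {x y} → 0# ≤ x → 0# ≤ y → 0# ≤ (x * y)

  open MonoidSum +-monoid public using (sum)

  ι : ℕ → Carrier
  ι n = n ×ℕ 1#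
    where open Algebra.Definitions.RawMonoid +-rawMonoid using () renaming (_×_ to _×ℕ_)

-- Hypergraphs: vertex set V = Fin n, edges indexed by Fin m,
-- edge j : Subset n is the j-th edge (a subset of V).

module _ {n m : ℕ} (edge : Fin m → Subset n) where

  deg : Subset m → Fin n → ℕ
  deg M v = sumℕ (mapL (λ j → if does (j ∈? M) then (if does (v ∈? edge j) then 1 else 0) else 0)
                       (allFinL m))

  IsBMatching : (b : Fin n → ℕ) → Subset m → Set
  IsBMatching b M = ∀ v → deg M v ℕ.≤ b v

  isBMatching? : (b : Fin n → ℕ) → Subset m → Bool
  isBMatching? b M = does (all? (λ v → deg M v ℕ.≤? b v))

  -- the greedy algorithm, processing the edges in index order
  -- 0,1,…,m-1 and adding edge j whenever M ∪ {j} is a b-matching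
  greedy : (b : Fin n → ℕ) → Subset m
  greedy b = foldl step ∅ (allFinL m)
    where
    step : Subset m → Fin m → Subset m
    step M j = if isBMatching? b (M ∪ ⁅ j ⁆) then M ∪ ⁅ j ⁆ else M


module _ {c ℓ₁ ℓ₂} (R : OrderedCommRing c ℓ₁ ℓ₂) where
  open OrderedCommRing R

  IsFracBMatching : {n m : ℕ} (edge : Fin m → Subset n) (b : Fin n → ℕ)
                    (x : Fin m → Carrier) → Set ℓ₂
  IsFracBMatching {n} {m} edge b x =
    (∀ j → (0# ≤ x j) × (x j ≤ 1#)) ×
    (∀ v → sum (λ j → if does (v ∈? edge j) then x j else 0#) ≤ ι (b v))

  greedyValue : {n m : ℕ} (edge : Fin m → Subset n) (M : Subset m)
                (w x : Fin m → Carrier) → Carrier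
  greedyValue edge M w x =
    sum (λ j → if does (j ∈? M)
                 then (ι ∣ edge j ∣ - (ι ∣ edge j ∣ - 1#) * x j) * w j
                 else 0#)

-- Weak LP duality with a greedy dual. Let M be the greedy b-matching and give each vertex v that M
-- saturates the potential y v = least weight of an M-edge at v (and y v = 0 otherwise). The greedy
-- algorithm rejects an edge only when one of its vertices is already saturated by heavier edges, so
-- w e ≤ Σ_{v ∈ e} y v for rejected e, while y v ≤ w e whenever v ∈ e ∈ M. Charging x e · w e for the
-- rejected edges to the potentials of their vertices, and using x(δ(v)) ≤ b v ≤ deg_M v at saturated
-- vertices, bounds their total by Σ_{e ∈ M} (1 - x e) Σ_{v ∈ e} y v ≤ Σ_{e ∈ M} (1 - x e) |e| w e.

module Submission where

open import Defs
open import Level using (Level; _⊔_)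
open import Data.Nat as ℕ using (ℕ)
open import Data.Fin as Fin using (Fin)
open import Data.Fin.Subset using (Subset)
open import Data.Product using (_×_)
open import Function.Definitions using (Injective)
open import Relation.Binary.PropositionalEquality using (_≡_)

open import Data.Bool using (Bool; true; false; not; if_then_else_)
import Data.Nat.Properties as ℕP
open import Data.Fin using (zero; suc; punchIn)
import Data.Fin.Properties as FinP
open import Data.Fin.Subset using (_∈_; _∉_; _∪_; ⁅_⁆; ∣_∣) renaming (⊥ to ∅)
open import Data.Fin.Subset.Properties using (_∈?_; x∈p∪q⁺; x∈p∪q⁻; x∈⁅x⁆; x∈⁅y⁆⇒x≡y; p⊆p∪q; ∉⊥)
open import Data.Vec using ([]; _∷_)
open import Data.Vec.Functional using (Vector; removeAt)
open import Data.List using (List; []; _∷_; foldl; filter) renaming (map to mapL; allFin to allFinL; tabulate to tabulateL)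
import Data.List.Properties as ListP
open import Data.Nat.ListAction using () renaming (sum to sumℕ)
open import Data.List.Membership.Propositional using () renaming (_∈_ to _∈ₗ_; _∉_ to _∉ₗ_)
open import Data.List.Membership.Propositional.Properties using (∈-allFin; ∈-filter⁺; ∈-filter⁻)
open import Data.List.Relation.Unary.Any using (here; there)
open import Data.List.Relation.Unary.All as All using (All; []; _∷_)
import Data.List.Relation.Unary.All.Properties as AllP
open import Data.List.Relation.Unary.AllPairs using (AllPairs; []; _∷_)
open import Data.List.Relation.Unary.AllPairs.Properties using (tabulate⁺-<)
open import Data.Product using (_,_; proj₁; proj₂; ∃-syntax)
open import Data.Sum using (_⊎_; inj₁; inj₂)
open import Function using (_∘_; mk⇔)
open import Relation.Nullary using (¬_; Dec; yes; no; does; contradiction)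
open import Relation.Nullary.Decidable using (dec-true; dec-false; does-⇔; _×-dec_)
open import Relation.Binary using (IsTotalOrder; TotalOrder)
import Relation.Binary.Reasoning.PartialOrder
import Relation.Binary.Reasoning.Setoid
import Relation.Binary.PropositionalEquality as ≡
open ≡ using (_≢_)
import Algebra.Properties.CommutativeMonoid.Sum as CommutativeMonoidSum

open CommutativeMonoidSum ℕP.+-0-commutativeMonoid using ()
  renaming (sum to ∑ℕ; sum-remove to ∑ℕ-remove; sum-cong-≗ to ∑ℕ-cong; sum-replicate-zero to ∑ℕ-zeros)

sumℕ-tabulate : ∀ {k} (f : Fin k → ℕ) → sumℕ (tabulateL f) ≡ ∑ℕ f
sumℕ-tabulate {ℕ.zero}  f = ≡.refl
sumℕ-tabulate {ℕ.suc k} f = ≡.cong (f zero ℕ.+_) (sumℕ-tabulate (f ∘ suc))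

sumℕ-map-allFin : ∀ {k} (f : Fin k → ℕ) → sumℕ (mapL f (allFinL k)) ≡ ∑ℕ f
sumℕ-map-allFin f = ≡.trans (≡.cong sumℕ (ListP.map-tabulate (λ i → i) f)) (sumℕ-tabulate f)

∑ℕ-increment : ∀ {k} (f g : Fin k → ℕ) (x : Fin k) →
               g x ≡ ℕ.suc (f x) → (∀ j → j ≢ x → g j ≡ f j) → ∑ℕ g ≡ ℕ.suc (∑ℕ f)
∑ℕ-increment {ℕ.suc k} f g x gx≡1+fx g≗f = begin
  ∑ℕ g                               ≡⟨ ∑ℕ-remove {i = x} g ⟩
  g x ℕ.+ ∑ℕ (removeAt g x)          ≡⟨ ≡.cong₂ ℕ._+_ gx≡1+fx (∑ℕ-cong (g≗f _ ∘ FinP.punchInᵢ≢i x)) ⟩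
  ℕ.suc (f x ℕ.+ ∑ℕ (removeAt f x))  ≡⟨ ≡.cong ℕ.suc (≡.sym (∑ℕ-remove {i = x} f)) ⟩
  ℕ.suc (∑ℕ f)                       ∎
  where open ≡.≡-Reasoning

module OrderedCommRingProperties {c ℓ₁ ℓ₂} (R : OrderedCommRing c ℓ₁ ℓ₂) where

  open OrderedCommRing R hiding (zero)
  open IsTotalOrder isTotalOrder using (total)
  open IsTotalOrder isTotalOrder public using ()
    renaming (refl to ≤-refl; trans to ≤-trans; reflexive to ≤-reflexive)
  open import Algebra.Properties.Group +-group using (\\-leftDividesʳ; //-rightDividesˡ)
  open import Algebra.Properties.AbelianGroup +-abelianGroup using (⁻¹-anti-homo‿-)
  open import Algebra.Properties.CommutativeSemigroup +-commutativeSemigroup using (x∙yz≈y∙xz)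
  open import Algebra.Properties.CommutativeSemigroup *-commutativeSemigroup
    using () renaming (x∙yz≈y∙xz to x*yz≈y*xz)
  open import Algebra.Properties.Ring ring using (-1*x≈-x; x[y-z]≈xy-xz; [y-z]x≈yx-zx; -‿involutive)
  open import Algebra.Properties.Semiring.Sum semiring using (sum-remove; ∑-comm; *-distribˡ-sum)
  open import Algebra.Properties.Semiring.Sum semiring public using (sum-cong-≋; ∑-distrib-+)
  open import Algebra.Properties.Monoid.Mult +-monoid using (×-homo-+)

  totalOrder : TotalOrder c ℓ₁ ℓ₂
  totalOrder = record { isTotalOrder = isTotalOrder }

  module ≤-Reasoning = Relation.Binary.Reasoning.PartialOrder (TotalOrder.poset totalOrder)
  module ≈-Reasoning = Relation.Binary.Reasoning.Setoid setoid

  +-monoʳ-≤ : ∀ z {x y} → x ≤ y → z + x ≤ z + y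
  +-monoʳ-≤ z {x} {y} x≤y = begin
    z + x ≈⟨ +-comm z x ⟩
    x + z ≤⟨ +-mono-≤ z x≤y ⟩
    y + z ≈⟨ +-comm y z ⟩
    z + y ∎
    where open ≤-Reasoning

  +-mono₂-≤ : ∀ {x y u v} → x ≤ y → u ≤ v → x + u ≤ y + v
  +-mono₂-≤ {y = y} {u} x≤y u≤v = ≤-trans (+-mono-≤ u x≤y) (+-monoʳ-≤ y u≤v)

  +-cancelˡ-≤ : ∀ z {x y} → z + x ≤ z + y → x ≤ y
  +-cancelˡ-≤ z {x} {y} z+x≤z+y = begin
    x             ≈⟨ sym (\\-leftDividesʳ z x) ⟩
    - z + (z + x) ≤⟨ +-monoʳ-≤ (- z) z+x≤z+y ⟩
    - z + (z + y) ≈⟨ \\-leftDividesʳ z y ⟩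
    y             ∎
    where open ≤-Reasoning

  x≤y⇒0≤y-x : ∀ {x y} → x ≤ y → 0# ≤ y - x
  x≤y⇒0≤y-x {x} {y} x≤y = begin
    0#    ≈⟨ sym (-‿inverseʳ x) ⟩
    x - x ≤⟨ +-mono-≤ (- x) x≤y ⟩
    y - x ∎
    where open ≤-Reasoning

  *-monoʳ-≤-nonNeg : ∀ {z} → 0# ≤ z → ∀ {x y} → x ≤ y → z * x ≤ z * y
  *-monoʳ-≤-nonNeg {z} 0≤z {x} {y} x≤y = begin
    z * x                   ≈⟨ sym (+-identityˡ (z * x)) ⟩
    0# + z * x              ≤⟨ +-mono-≤ (z * x) 0≤z*y-z*x ⟩
    (z * y - z * x) + z * x ≈⟨ //-rightDividesˡ (z * x) (z * y) ⟩
    z * y                   ∎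
    where
    open ≤-Reasoning
    0≤z*y-z*x : 0# ≤ z * y - z * x
    0≤z*y-z*x = ≤-trans (*-nonneg 0≤z (x≤y⇒0≤y-x x≤y)) (≤-reflexive (x[y-z]≈xy-xz z y x))

  0≤1 : 0# ≤ 1#
  0≤1 with total 0# 1#
  ... | inj₁ 0≤1 = 0≤1
  ... | inj₂ 1≤0 = begin
    0#           ≤⟨ *-nonneg 0≤-1 0≤-1 ⟩
    - 1# * - 1#  ≈⟨ -1*x≈-x (- 1#) ⟩
    - - 1#       ≈⟨ -‿involutive 1# ⟩
    1#           ∎
    where
    open ≤-Reasoning
    0≤-1 : 0# ≤ - 1#
    0≤-1 = ≤-trans (x≤y⇒0≤y-x 1≤0) (≤-reflexive (+-identityˡ (- 1#)))

  +-nonNeg : ∀ {x y} → 0# ≤ x → 0# ≤ y → 0# ≤ x + y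
  +-nonNeg 0≤x 0≤y = ≤-trans (≤-reflexive (sym (+-identityʳ 0#))) (+-mono₂-≤ 0≤x 0≤y)

  sum-mono-≤ : ∀ {k} {f g : Vector Carrier k} → (∀ i → f i ≤ g i) → sum f ≤ sum g
  sum-mono-≤ {ℕ.zero}  f≤g = ≤-refl
  sum-mono-≤ {ℕ.suc k} f≤g = +-mono₂-≤ (f≤g zero) (sum-mono-≤ (f≤g ∘ suc))

  sum-nonNeg : ∀ {k} {f : Vector Carrier k} → (∀ i → 0# ≤ f i) → 0# ≤ sum f
  sum-nonNeg {ℕ.zero}  0≤f = ≤-refl
  sum-nonNeg {ℕ.suc k} 0≤f = +-nonNeg (0≤f zero) (sum-nonNeg (0≤f ∘ suc))

  ≤-sum : ∀ {k} {f : Vector Carrier k} → (∀ i → 0# ≤ f i) → ∀ i → f i ≤ sum f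
  ≤-sum {ℕ.suc k} {f} 0≤f i = begin
    f i                        ≈⟨ sym (+-identityʳ (f i)) ⟩
    f i + 0#                   ≤⟨ +-monoʳ-≤ (f i) (sum-nonNeg (0≤f ∘ punchIn i)) ⟩
    f i + sum (removeAt f i)   ≈⟨ sym (sum-remove f) ⟩
    sum f                      ∎
    where open ≤-Reasoning

  ι-homo-+ : ∀ p q → ι (p ℕ.+ q) ≈ ι p + ι q
  ι-homo-+ = ×-homo-+ 1#

  ι-nonNeg : ∀ p → 0# ≤ ι p
  ι-nonNeg ℕ.zero    = ≤-refl
  ι-nonNeg (ℕ.suc p) = +-nonNeg 0≤1 (ι-nonNeg p)

  ι-mono-≤ : ∀ {p q} → p ℕ.≤ q → ι p ≤ ι q
  ι-mono-≤ {p} {q} p≤q = begin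
    ι p                 ≈⟨ sym (+-identityʳ (ι p)) ⟩
    ι p + 0#            ≤⟨ +-monoʳ-≤ (ι p) (ι-nonNeg (q ℕ.∸ p)) ⟩
    ι p + ι (q ℕ.∸ p)   ≈⟨ sym (ι-homo-+ p (q ℕ.∸ p)) ⟩
    ι (p ℕ.+ (q ℕ.∸ p)) ≡⟨ ≡.cong ι (ℕP.m+[n∸m]≡n p≤q) ⟩
    ι q                 ∎
    where open ≤-Reasoning

  ι-∑ℕ : ∀ {k} (f : Fin k → ℕ) → ι (∑ℕ f) ≈ sum (ι ∘ f)
  ι-∑ℕ {ℕ.zero}  f = refl
  ι-∑ℕ {ℕ.suc k} f = trans (ι-homo-+ (f zero) (∑ℕ (f ∘ suc))) (+-congˡ (ι-∑ℕ (f ∘ suc)))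

  x+[y-x]≈y : ∀ x y → x + (y - x) ≈ y
  x+[y-x]≈y x y = trans (x∙yz≈y∙xz x y (- x)) (trans (+-congˡ (-‿inverseʳ x)) (+-identityʳ y))

  when : Bool → Carrier → Carrier
  when p x = if p then x else 0#

  when-nonNeg : ∀ p {x} → 0# ≤ x → 0# ≤ when p x
  when-nonNeg true  0≤x = 0≤x
  when-nonNeg false _   = ≤-refl

  ≤-when : ∀ {p x z} → p ≡ true → z ≤ x → z ≤ when p x
  ≤-when ≡.refl z≤x = z≤x

  when-≤ : ∀ p {x z} → 0# ≤ z → x ≤ z → when p x ≤ z
  when-≤ true  _   x≤z = x≤z
  when-≤ false 0≤z _   = 0≤z

  when-cong : ∀ p {x y} → x ≈ y → when p x ≈ when p y
  when-cong true  x≈y = x≈y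
  when-cong false x≈y = refl

  when-distrib-+ : ∀ p x y → when p (x + y) ≈ when p x + when p y
  when-distrib-+ true  x y = refl
  when-distrib-+ false x y = sym (+-identityʳ 0#)

  when-+-when-not : ∀ p x → x ≈ when p x + when (not p) x
  when-+-when-not true  x = sym (+-identityʳ x)
  when-+-when-not false x = sym (+-identityˡ x)

  *-when-comm : ∀ p x y → x * when p y ≈ y * when p x
  *-when-comm true  x y = *-comm x y
  *-when-comm false x y = trans (zeroʳ x) (sym (zeroʳ y))

  sum-split : ∀ {k} (p : Fin k → Bool) (f : Vector Carrier k) →
              sum f ≈ sum (λ j → when (p j) (f j)) + sum (λ j → when (not (p j)) (f j))
  sum-split {k} p f = trans (sum-cong-≋ (λ j → when-+-when-not (p j) (f j))) (∑-distrib-+ {k} _ _)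

  sum-incidence-swap : ∀ {k l} (incident : Fin k → Fin l → Bool) (a : Vector Carrier k) (y : Vector Carrier l) →
    sum (λ j → a j * sum (λ v → when (incident j v) (y v))) ≈
    sum (λ v → y v * sum (λ j → when (incident j v) (a j)))
  sum-incidence-swap {k} {l} incident a y = begin
    sum (λ j → a j * sum (λ v → when (incident j v) (y v)))  ≈⟨ sum-cong-≋ (λ j → *-distribˡ-sum {l} (a j) _) ⟩
    sum (λ j → sum (λ v → a j * when (incident j v) (y v)))  ≈⟨ ∑-comm {k} {l} _ ⟩
    sum (λ v → sum (λ j → a j * when (incident j v) (y v)))  ≈⟨ sum-cong-≋ (λ v → sum-cong-≋ (λ j →
                                                                    *-when-comm (incident j v) (a j) (y v))) ⟩
    sum (λ v → sum (λ j → y v * when (incident j v) (a j)))  ≈⟨ sum-cong-≋ (λ v → sym (*-distribˡ-sum {k} (y v) _)) ⟩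
    sum (λ v → y v * sum (λ j → when (incident j v) (a j)))  ∎
    where open ≈-Reasoning

  sum-when-const : ∀ {k} (e : Subset k) x → sum (λ v → when (does (v ∈? e)) x) ≈ ι ∣ e ∣ * x
  sum-when-const []          x = sym (zeroˡ x)
  sum-when-const (true ∷ e)  x = begin
    x + sum (λ v → when (does (v ∈? e)) x) ≈⟨ +-cong (sym (*-identityˡ x)) (sum-when-const e x) ⟩
    1# * x + ι ∣ e ∣ * x                   ≈⟨ sym (distribʳ x 1# (ι ∣ e ∣)) ⟩
    (1# + ι ∣ e ∣) * x                     ∎
    where open ≈-Reasoning
  sum-when-const (false ∷ e) x = trans (+-identityˡ _) (sum-when-const e x)

  sum-when-≤ : ∀ {k} (e : Subset k) {y : Vector Carrier k} {x} → (∀ {v} → v ∈ e → y v ≤ x) →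
               sum (λ v → when (does (v ∈? e)) (y v)) ≤ ι ∣ e ∣ * x
  sum-when-≤ e {y} {x} y≤x = begin
    sum (λ v → when (does (v ∈? e)) (y v)) ≤⟨ sum-mono-≤ pointwise ⟩
    sum (λ v → when (does (v ∈? e)) x)     ≈⟨ sum-when-const e x ⟩
    ι ∣ e ∣ * x                            ∎
    where
    open ≤-Reasoning
    pointwise : ∀ v → when (does (v ∈? e)) (y v) ≤ when (does (v ∈? e)) x
    pointwise v with v ∈? e
    ... | yes v∈e = y≤x v∈e
    ... | no  _   = ≤-refl

  kept-edge-identity : ∀ k x w → x * w + (1# - x) * (k * w) ≈ (k - (k - 1#) * x) * w
  kept-edge-identity k x w = sym (begin
    (k - (k - 1#) * x) * w              ≈⟨ [y-z]x≈yx-zx w k ((k - 1#) * x) ⟩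
    k * w - (k - 1#) * x * w            ≈⟨ -‿cong-right (*-assoc (k - 1#) x w) ⟩
    k * w - (k - 1#) * (x * w)          ≈⟨ -‿cong-right ([y-z]x≈yx-zx (x * w) k 1#) ⟩
    k * w - (k * (x * w) - 1# * (x * w)) ≈⟨ -‿cong-right (+-congˡ (-‿cong (*-identityˡ (x * w)))) ⟩
    k * w - (k * (x * w) - x * w)       ≈⟨ +-congˡ (⁻¹-anti-homo‿- (k * (x * w)) (x * w)) ⟩
    k * w + (x * w - k * (x * w))       ≈⟨ x∙yz≈y∙xz (k * w) (x * w) (- (k * (x * w))) ⟩
    x * w + (k * w - k * (x * w))       ≈⟨ +-congˡ (sym slack-term) ⟩
    x * w + (1# - x) * (k * w)          ∎)
    where
    open ≈-Reasoning
    -‿cong-right : ∀ {a b d} → b ≈ d → a - b ≈ a - d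
    -‿cong-right b≈d = +-congˡ (-‿cong b≈d)
    slack-term : (1# - x) * (k * w) ≈ k * w - k * (x * w)
    slack-term = begin
      (1# - x) * (k * w)          ≈⟨ [y-z]x≈yx-zx (k * w) 1# x ⟩
      1# * (k * w) - x * (k * w)  ≈⟨ +-cong (*-identityˡ (k * w)) (-‿cong (x*yz≈y*xz x k w)) ⟩
      k * w - k * (x * w)         ∎

∪⁅⁆⁻ : ∀ {k} {S : Subset k} {x j} → j ∈ S ∪ ⁅ x ⁆ → j ∈ S ⊎ j ≡ x
∪⁅⁆⁻ {S = S} {x} j∈ with x∈p∪q⁻ S ⁅ x ⁆ j∈
... | inj₁ j∈S  = inj₁ j∈S
... | inj₂ j∈⁅x⁆ = inj₂ (x∈⁅y⁆⇒x≡y x j∈⁅x⁆)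

∈-∪⁅⁆-≢ : ∀ {k} (S : Subset k) {x j} → j ≢ x → does (j ∈? S ∪ ⁅ x ⁆) ≡ does (j ∈? S)
∈-∪⁅⁆-≢ S {x} {j} j≢x = does-⇔ (mk⇔ to (p⊆p∪q ⁅ x ⁆)) (j ∈? S ∪ ⁅ x ⁆) (j ∈? S)
  where
  to : j ∈ S ∪ ⁅ x ⁆ → j ∈ S
  to j∈ with ∪⁅⁆⁻ j∈
  ... | inj₁ j∈S = j∈S
  ... | inj₂ j≡x = contradiction j≡x j≢x

module Degree {n m : ℕ} (edge : Fin m → Subset n) where

  open ≡ using (refl; cong; sym; trans)

  incidence : Subset m → Fin n → Fin m → ℕ
  incidence M v j = if does (j ∈? M) then (if does (v ∈? edge j) then 1 else 0) else 0

  deg≡∑ℕ : ∀ M v → deg edge M v ≡ ∑ℕ (incidence M v)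
  deg≡∑ℕ M v = sumℕ-map-allFin (incidence M v)

  incidence-∉ : ∀ {M} v {j} → j ∉ M → incidence M v j ≡ 0
  incidence-∉ {M} v {j} j∉M rewrite dec-false (j ∈? M) j∉M = refl

  incidence-∉-edge : ∀ {M} v {j} → v ∉ edge j → incidence M v j ≡ 0
  incidence-∉-edge {M} v {j} v∉ with does (j ∈? M)
  ... | true  = cong (λ p → if p then 1 else 0) (dec-false (v ∈? edge j) v∉)
  ... | false = refl

  incidence-∈ : ∀ {M} v {j} → j ∈ M → v ∈ edge j → incidence M v j ≡ 1
  incidence-∈ {M} v {j} j∈M v∈ rewrite dec-true (j ∈? M) j∈M | dec-true (v ∈? edge j) v∈ = refl

  incidence-∪⁅⁆-≢ : ∀ S {x j} v → j ≢ x → incidence (S ∪ ⁅ x ⁆) v j ≡ incidence S v j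
  incidence-∪⁅⁆-≢ S v j≢x = cong (λ p → if p then _ else 0) (∈-∪⁅⁆-≢ S j≢x)

  deg-∅ : ∀ v → deg edge ∅ v ≡ 0
  deg-∅ v = trans (deg≡∑ℕ ∅ v) (trans (∑ℕ-cong (λ j → incidence-∉ v (∉⊥ {x = j}))) (∑ℕ-zeros m))

  deg-∪⁅⁆-∉ : ∀ S {x} v → v ∉ edge x → deg edge (S ∪ ⁅ x ⁆) v ≡ deg edge S v
  deg-∪⁅⁆-∉ S {x} v v∉ = trans (deg≡∑ℕ _ v) (trans (∑ℕ-cong pointwise) (sym (deg≡∑ℕ S v)))
    where
    pointwise : ∀ j → incidence (S ∪ ⁅ x ⁆) v j ≡ incidence S v j
    pointwise j with j FinP.≟ x
    ... | yes refl = trans (incidence-∉-edge v v∉) (sym (incidence-∉-edge v v∉))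
    ... | no j≢x   = incidence-∪⁅⁆-≢ S v j≢x

  deg-∪⁅⁆-∈ : ∀ {S x} v → x ∉ S → v ∈ edge x → deg edge (S ∪ ⁅ x ⁆) v ≡ ℕ.suc (deg edge S v)
  deg-∪⁅⁆-∈ {S} {x} v x∉S v∈ = trans (deg≡∑ℕ _ v) (trans
    (∑ℕ-increment (incidence S v) (incidence (S ∪ ⁅ x ⁆) v) x
      (trans (incidence-∈ v (x∈p∪q⁺ (inj₂ (x∈⁅x⁆ x))) v∈) (cong ℕ.suc (sym (incidence-∉ v x∉S))))
      (λ j → incidence-∪⁅⁆-≢ S v))
    (cong ℕ.suc (sym (deg≡∑ℕ S v))))

module GreedyInvariant {n m : ℕ} (edge : Fin m → Subset n) (b : Fin n → ℕ) where

  open Degree edge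
  open ≡ using (refl; cong; sym; trans)

  Saturated : Subset m → Fin n → Set
  Saturated M v = b v ℕ.≤ deg edge M v

  Blocked : Subset m → Fin m → Set
  Blocked M j = ∃[ v ] v ∈ edge j × Saturated M v × (∀ {k} → k ∈ M → v ∈ edge k → k Fin.< j)

  isBMatching-dec : ∀ M → Dec (IsBMatching edge b M)
  isBMatching-dec M = FinP.all? (λ v → deg edge M v ℕ.≤? b v)

  -- The step function local to greedy: greedy edge b is definitionally foldl greedyStep ∅ (allFin m).
  greedyStep : Subset m → Fin m → Subset m
  greedyStep M j = if isBMatching? edge b (M ∪ ⁅ j ⁆) then M ∪ ⁅ j ⁆ else M

  greedyStep-accept : ∀ {S x} → IsBMatching edge b (S ∪ ⁅ x ⁆) → greedyStep S x ≡ S ∪ ⁅ x ⁆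
  greedyStep-accept {S} {x} ok =
    cong (λ p → if p then S ∪ ⁅ x ⁆ else S) (dec-true (isBMatching-dec (S ∪ ⁅ x ⁆)) ok)

  greedyStep-reject : ∀ {S x} → ¬ IsBMatching edge b (S ∪ ⁅ x ⁆) → greedyStep S x ≡ S
  greedyStep-reject {S} {x} ¬ok =
    cong (λ p → if p then S ∪ ⁅ x ⁆ else S) (dec-false (isBMatching-dec (S ∪ ⁅ x ⁆)) ¬ok)

  blocked-∪⁅⁆ : ∀ {S x j} → x ∉ S → IsBMatching edge b (S ∪ ⁅ x ⁆) → Blocked S j → Blocked (S ∪ ⁅ x ⁆) j
  blocked-∪⁅⁆ {S} {x} x∉S ok (v , v∈j , saturated , earlier) with v ∈? edge x
  ... | yes v∈x = contradiction (ok v) (ℕP.<⇒≱ (begin-strict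
    b v                      ≤⟨ saturated ⟩
    deg edge S v             <⟨ ℕP.n<1+n _ ⟩
    ℕ.suc (deg edge S v)     ≡⟨ sym (deg-∪⁅⁆-∈ v x∉S v∈x) ⟩
    deg edge (S ∪ ⁅ x ⁆) v   ∎))
    where open ℕP.≤-Reasoning
  ... | no v∉x = v , v∈j , ℕP.≤-trans saturated (ℕP.≤-reflexive (sym (deg-∪⁅⁆-∉ S v v∉x))) , earlier′
    where
    earlier′ : ∀ {k} → k ∈ S ∪ ⁅ x ⁆ → v ∈ edge k → k Fin.< _
    earlier′ k∈ v∈k with ∪⁅⁆⁻ k∈
    ... | inj₁ k∈S  = earlier k∈S v∈k
    ... | inj₂ refl = contradiction v∈k v∉x

  rejected-blocked : ∀ {S x} → IsBMatching edge b S → x ∉ S → (∀ {k} → k ∈ S → k Fin.< x) →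
                     ¬ IsBMatching edge b (S ∪ ⁅ x ⁆) → Blocked S x
  rejected-blocked {S} {x} ok x∉S earlier ¬ok with FinP.¬∀⟶∃¬ n _ (λ v → deg edge (S ∪ ⁅ x ⁆) v ℕ.≤? b v) ¬ok
  ... | v , overfull with v ∈? edge x
  ...   | yes v∈x = v , v∈x , saturated , λ k∈S _ → earlier k∈S
    where
    saturated : b v ℕ.≤ deg edge S v
    saturated = ℕP.≤-pred (ℕP.≤-trans (ℕP.≰⇒> overfull) (ℕP.≤-reflexive (deg-∪⁅⁆-∈ v x∉S v∈x)))
  ...   | no v∉x  = contradiction (ℕP.≤-trans (ℕP.≤-reflexive (deg-∪⁅⁆-∉ S v v∉x)) (ok v)) overfull

  record Invariant (S : Subset m) (todo : List (Fin m)) : Set where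
    field
      matching : IsBMatching edge b S
      blocked  : ∀ {j} → j ∉ S → j ∉ₗ todo → Blocked S j
      precedes : ∀ {k} → k ∈ S → All (k Fin.<_) todo

  open Invariant

  next-∉ : ∀ {S x xs} → Invariant S (x ∷ xs) → x ∉ S
  next-∉ inv x∈S = FinP.<-irrefl refl (All.head (precedes inv x∈S))

  invariant-accept : ∀ {S x xs} → Invariant S (x ∷ xs) → All (x Fin.<_) xs →
                     IsBMatching edge b (S ∪ ⁅ x ⁆) → Invariant (S ∪ ⁅ x ⁆) xs
  invariant-accept {S} {x} {xs} inv x<xs ok = record
    { matching = ok
    ; blocked  = blocked′
    ; precedes = precedes′
    }
    where
    blocked′ : ∀ {j} → j ∉ S ∪ ⁅ x ⁆ → j ∉ₗ xs → Blocked (S ∪ ⁅ x ⁆) j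
    blocked′ j∉ j∉xs = blocked-∪⁅⁆ (next-∉ inv) ok (blocked inv (j∉ ∘ x∈p∪q⁺ ∘ inj₁) j∉x∷xs)
      where
      j∉x∷xs : _ ∉ₗ x ∷ xs
      j∉x∷xs (here refl) = j∉ (x∈p∪q⁺ (inj₂ (x∈⁅x⁆ x)))
      j∉x∷xs (there j∈xs) = j∉xs j∈xs
    precedes′ : ∀ {k} → k ∈ S ∪ ⁅ x ⁆ → All (k Fin.<_) xs
    precedes′ k∈ with ∪⁅⁆⁻ k∈
    ... | inj₁ k∈S  = All.tail (precedes inv k∈S)
    ... | inj₂ refl = x<xs

  invariant-reject : ∀ {S x xs} → Invariant S (x ∷ xs) → ¬ IsBMatching edge b (S ∪ ⁅ x ⁆) → Invariant S xs
  invariant-reject {S} {x} {xs} inv ¬ok = record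
    { matching = matching inv
    ; blocked  = blocked′
    ; precedes = All.tail ∘ precedes inv
    }
    where
    blocked′ : ∀ {j} → j ∉ S → j ∉ₗ xs → Blocked S j
    blocked′ {j} j∉S j∉xs with j FinP.≟ x
    ... | yes refl = rejected-blocked (matching inv) j∉S (All.head ∘ precedes inv) ¬ok
    ... | no j≢x   = blocked inv j∉S λ { (here j≡x) → j≢x j≡x ; (there j∈xs) → j∉xs j∈xs }

  invariant-step : ∀ {S x xs} → Invariant S (x ∷ xs) → All (x Fin.<_) xs → Invariant (greedyStep S x) xs
  invariant-step {S} {x} inv x<xs with isBMatching-dec (S ∪ ⁅ x ⁆)
  ... | yes ok = ≡.subst (λ T → Invariant T _) (sym (greedyStep-accept ok)) (invariant-accept inv x<xs ok)
  ... | no ¬ok = ≡.subst (λ T → Invariant T _) (sym (greedyStep-reject ¬ok)) (invariant-reject inv ¬ok)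

  invariant-foldl : ∀ {S} xs → AllPairs Fin._<_ xs → Invariant S xs → Invariant (foldl greedyStep S xs) []
  invariant-foldl []       []               inv = inv
  invariant-foldl (x ∷ xs) (x<xs ∷ sorted) inv = invariant-foldl xs sorted (invariant-step inv x<xs)

  invariant-∅ : Invariant ∅ (allFinL m)
  invariant-∅ = record
    { matching = λ v → ℕP.≤-trans (ℕP.≤-reflexive (deg-∅ v)) ℕ.z≤n
    ; blocked  = λ {j} _ j∉ → contradiction (∈-allFin j) j∉
    ; precedes = λ k∈∅ → contradiction k∈∅ ∉⊥
    }

  greedy-invariant : Invariant (greedy edge b) []
  greedy-invariant = invariant-foldl (allFinL m) (tabulate⁺-< (λ i<j → i<j)) invariant-∅

  greedy-isBMatching : IsBMatching edge b (greedy edge b)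
  greedy-isBMatching = matching greedy-invariant

  greedy-blocks-rejected : ∀ {j} → j ∉ greedy edge b → Blocked (greedy edge b) j
  greedy-blocks-rejected j∉ = blocked greedy-invariant j∉ λ ()

module WeakDuality {c ℓ₁ ℓ₂} (R : OrderedCommRing c ℓ₁ ℓ₂) {n m : ℕ} (edge : Fin m → Subset n)
                   (b : Fin n → ℕ) (M : Subset m) (w : Fin m → OrderedCommRing.Carrier R) where

  open OrderedCommRing R hiding (zero)
  open OrderedCommRingProperties R
  open Degree edge using (incidence; deg≡∑ℕ)

  kept : Fin m → Bool
  kept j = does (j ∈? M)

  _∈ᵇ_ : Fin n → Fin m → Bool
  v ∈ᵇ j = does (v ∈? edge j)

  record DualCertificate (y : Fin n → Carrier) : Set (ℓ₁ ⊔ ℓ₂) where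
    field
      nonNeg          : ∀ v → 0# ≤ y v
      below-kept      : ∀ {j v} → j ∈ M → v ∈ edge j → y v ≤ w j
      covers-rejected : ∀ {j} → j ∉ M → w j ≤ sum (λ v → when (v ∈ᵇ j) (y v))
      complementary   : ∀ v → y v ≈ 0# ⊎ b v ℕ.≤ deg edge M v

  ι-deg : ∀ v → ι (deg edge M v) ≈ sum (λ j → when (v ∈ᵇ j) (when (kept j) 1#))
  ι-deg v = trans (reflexive (≡.cong ι (deg≡∑ℕ M v))) (trans (ι-∑ℕ (incidence M v)) (sum-cong-≋ pointwise))
    where
    pointwise : ∀ j → ι (incidence M v j) ≈ when (v ∈ᵇ j) (when (kept j) 1#)
    pointwise j with kept j | v ∈ᵇ j
    ... | true  | true  = +-identityʳ 1#
    ... | true  | false = refl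
    ... | false | true  = refl
    ... | false | false = refl

  module _ {y : Fin n → Carrier} (certificate : DualCertificate y) (x : Fin m → Carrier)
           (fractional : IsFracBMatching R edge b x) where

    open DualCertificate certificate

    keptLoad rejectedLoad keptSlack : Fin n → Carrier
    keptLoad     v = sum (λ j → when (v ∈ᵇ j) (when (kept j) (x j)))
    rejectedLoad v = sum (λ j → when (v ∈ᵇ j) (when (not (kept j)) (x j)))
    keptSlack    v = sum (λ j → when (v ∈ᵇ j) (when (kept j) (1# - x j)))

    load-split : ∀ v → sum (λ j → when (v ∈ᵇ j) (x j)) ≈ keptLoad v + rejectedLoad v
    load-split v = trans (sum-cong-≋ pointwise) (∑-distrib-+ {m} _ _)
      where
      pointwise : ∀ j → when (v ∈ᵇ j) (x j) ≈
                        when (v ∈ᵇ j) (when (kept j) (x j)) + when (v ∈ᵇ j) (when (not (kept j)) (x j))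
      pointwise j = trans (when-cong (v ∈ᵇ j) (when-+-when-not (kept j) (x j))) (when-distrib-+ (v ∈ᵇ j) _ _)

    deg-split : ∀ v → ι (deg edge M v) ≈ keptLoad v + keptSlack v
    deg-split v = trans (ι-deg v) (trans (sum-cong-≋ pointwise) (∑-distrib-+ {m} _ _))
      where
      pointwise : ∀ j → when (v ∈ᵇ j) (when (kept j) 1#) ≈
                        when (v ∈ᵇ j) (when (kept j) (x j)) + when (v ∈ᵇ j) (when (kept j) (1# - x j))
      pointwise j = trans (when-cong (v ∈ᵇ j) (trans (when-cong (kept j) (sym (x+[y-x]≈y (x j) 1#)))
                                                     (when-distrib-+ (kept j) _ _)))
                          (when-distrib-+ (v ∈ᵇ j) _ _)

    rejectedLoad≤keptSlack : ∀ v → b v ℕ.≤ deg edge M v → rejectedLoad v ≤ keptSlack v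
    rejectedLoad≤keptSlack v saturated = +-cancelˡ-≤ (keptLoad v) (begin
      keptLoad v + rejectedLoad v     ≈⟨ sym (load-split v) ⟩
      sum (λ j → when (v ∈ᵇ j) (x j)) ≤⟨ proj₂ fractional v ⟩
      ι (b v)                         ≤⟨ ι-mono-≤ saturated ⟩
      ι (deg edge M v)                ≈⟨ deg-split v ⟩
      keptLoad v + keptSlack v        ∎)
      where open ≤-Reasoning

    rejectedValue≤keptSlackValue :
      sum (λ j → when (not (kept j)) (x j * w j)) ≤ sum (λ j → when (kept j) ((1# - x j) * (ι ∣ edge j ∣ * w j)))
    rejectedValue≤keptSlackValue = begin
      sum (λ j → when (not (kept j)) (x j * w j))                      ≤⟨ sum-mono-≤ rejected ⟩
      sum (λ j → when (not (kept j)) (x j) * sum (λ v → when (v ∈ᵇ j) (y v)))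
                                                                       ≈⟨ sum-incidence-swap (λ j v → v ∈ᵇ j) _ y ⟩
      sum (λ v → y v * rejectedLoad v)                                 ≤⟨ sum-mono-≤ complementary-slackness ⟩
      sum (λ v → y v * keptSlack v)                                    ≈⟨ sym (sum-incidence-swap (λ j v → v ∈ᵇ j) _ y) ⟩
      sum (λ j → when (kept j) (1# - x j) * sum (λ v → when (v ∈ᵇ j) (y v)))
                                                                       ≤⟨ sum-mono-≤ kept-bound ⟩
      sum (λ j → when (kept j) ((1# - x j) * (ι ∣ edge j ∣ * w j)))    ∎
      where
      open ≤-Reasoning
      rejected : ∀ j → when (not (kept j)) (x j * w j) ≤ when (not (kept j)) (x j) * sum (λ v → when (v ∈ᵇ j) (y v))
      rejected j with j ∈? M
      ... | yes _   = ≤-reflexive (sym (zeroˡ _))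
      ... | no  j∉M = *-monoʳ-≤-nonNeg (proj₁ (proj₁ fractional j)) (covers-rejected j∉M)
      complementary-slackness : ∀ v → y v * rejectedLoad v ≤ y v * keptSlack v
      complementary-slackness v with complementary v
      ... | inj₁ y≈0       = ≤-reflexive (trans (*-congʳ y≈0) (trans (zeroˡ _) (sym (trans (*-congʳ y≈0) (zeroˡ _)))))
      ... | inj₂ saturated = *-monoʳ-≤-nonNeg (nonNeg v) (rejectedLoad≤keptSlack v saturated)
      kept-bound : ∀ j → when (kept j) (1# - x j) * sum (λ v → when (v ∈ᵇ j) (y v)) ≤
                         when (kept j) ((1# - x j) * (ι ∣ edge j ∣ * w j))
      kept-bound j with j ∈? M
      ... | yes j∈M = *-monoʳ-≤-nonNeg (x≤y⇒0≤y-x (proj₂ (proj₁ fractional j)))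
                                         (sum-when-≤ (edge j) (below-kept j∈M))
      ... | no  _   = ≤-reflexive (zeroˡ _)

    fractionalValue≤greedyValue : sum (λ j → x j * w j) ≤ greedyValue R edge M w x
    fractionalValue≤greedyValue = begin
      sum (λ j → x j * w j)
        ≈⟨ sum-split kept (λ j → x j * w j) ⟩
      sum (λ j → when (kept j) (x j * w j)) + sum (λ j → when (not (kept j)) (x j * w j))
        ≤⟨ +-monoʳ-≤ _ rejectedValue≤keptSlackValue ⟩
      sum (λ j → when (kept j) (x j * w j)) + sum (λ j → when (kept j) ((1# - x j) * (ι ∣ edge j ∣ * w j)))
        ≈⟨ sym (∑-distrib-+ {m} _ _) ⟩
      sum (λ j → when (kept j) (x j * w j) + when (kept j) ((1# - x j) * (ι ∣ edge j ∣ * w j)))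
        ≈⟨ sum-cong-≋ (λ j → trans (sym (when-distrib-+ (kept j) _ _))
                                    (when-cong (kept j) (kept-edge-identity (ι ∣ edge j ∣) (x j) (w j)))) ⟩
      greedyValue R edge M w x
        ∎
      where open ≤-Reasoning

module GreedyCertificate {c ℓ₁ ℓ₂} (R : OrderedCommRing c ℓ₁ ℓ₂) where

  open OrderedCommRing R hiding (zero)
  open OrderedCommRingProperties R

  module _ {n m : ℕ} (edge : Fin m → Subset n) (b : Fin n → ℕ) (w : Fin m → Carrier)
           (w-nonNeg : ∀ j → 0# ≤ w j) (w-antitone : ∀ i j → i Fin.≤ j → w j ≤ w i) where

    open GreedyInvariant edge b
    open WeakDuality R edge b (greedy edge b) w
    open import Data.List.Extrema totalOrder using (min; min≤xs; v≤min⁺)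

    M : Subset m
    M = greedy edge b

    keptAt? : ∀ v k → Dec (k ∈ M × v ∈ edge k)
    keptAt? v k = k ∈? M ×-dec v ∈? edge k

    keptAt : Fin n → List (Fin m)
    keptAt v = filter (keptAt? v) (allFinL m)

    ∈-keptAt⁺ : ∀ {j v} → j ∈ M → v ∈ edge j → j ∈ₗ keptAt v
    ∈-keptAt⁺ {j} {v} j∈M v∈j = ∈-filter⁺ (keptAt? v) (∈-allFin j) (j∈M , v∈j)

    ∈-keptAt⁻ : ∀ {k v} → k ∈ₗ keptAt v → k ∈ M × v ∈ edge k
    ∈-keptAt⁻ {v = v} k∈ = proj₂ (∈-filter⁻ (keptAt? v) {xs = allFinL m} k∈)

    -- sum w stands in for the minimum over an empty set of kept edges.
    lightestKeptAt : Fin n → Carrier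
    lightestKeptAt v = min (sum w) (mapL w (keptAt v))

    saturated? : ∀ v → Dec (Saturated M v)
    saturated? v = b v ℕ.≤? deg edge M v

    potential : Fin n → Carrier
    potential v = when (does (saturated? v)) (lightestKeptAt v)

    lightestKeptAt-nonNeg : ∀ v → 0# ≤ lightestKeptAt v
    lightestKeptAt-nonNeg v = v≤min⁺ (sum-nonNeg w-nonNeg) (AllP.map⁺ (All.universal w-nonNeg (keptAt v)))

    lightestKeptAt-≤ : ∀ {j v} → j ∈ M → v ∈ edge j → lightestKeptAt v ≤ w j
    lightestKeptAt-≤ {j} {v} j∈M v∈j =
      All.lookup (AllP.map⁻ (min≤xs (sum w) (mapL w (keptAt v)))) (∈-keptAt⁺ j∈M v∈j)

    ≤-lightestKeptAt : ∀ {j v} → (∀ {k} → k ∈ M → v ∈ edge k → k Fin.< j) → w j ≤ lightestKeptAt v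
    ≤-lightestKeptAt {j} {v} earlier = v≤min⁺ (≤-sum w-nonNeg j) (AllP.map⁺ (All.tabulate {xs = keptAt v} λ k∈ →
      let (k∈M , v∈k) = ∈-keptAt⁻ k∈ in w-antitone _ j (ℕP.<⇒≤ (earlier k∈M v∈k))))

    potential-nonNeg : ∀ v → 0# ≤ potential v
    potential-nonNeg v = when-nonNeg _ (lightestKeptAt-nonNeg v)

    potential-certificate : DualCertificate potential
    potential-certificate = record
      { nonNeg          = potential-nonNeg
      ; below-kept      = λ {j} j∈M v∈j → when-≤ _ (w-nonNeg j) (lightestKeptAt-≤ j∈M v∈j)
      ; covers-rejected = covers-rejected
      ; complementary   = λ v → complementary (saturated? v)
      }
      where
      covers-rejected : ∀ {j} → j ∉ M → w j ≤ sum (λ v → when (v ∈ᵇ j) (potential v))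
      covers-rejected {j} j∉M with greedy-blocks-rejected j∉M
      ... | v , v∈j , saturated , earlier = begin
        w j                                     ≤⟨ ≤-when (dec-true (saturated? v) saturated) (≤-lightestKeptAt earlier) ⟩
        potential v                             ≤⟨ ≤-when (dec-true (v ∈? edge j) v∈j) ≤-refl ⟩
        when (v ∈ᵇ j) (potential v)             ≤⟨ ≤-sum (λ u → when-nonNeg (u ∈ᵇ j) (potential-nonNeg u)) v ⟩
        sum (λ u → when (u ∈ᵇ j) (potential u)) ∎
        where open ≤-Reasoning

      complementary : ∀ {v} (d : Dec (Saturated M v)) → when (does d) (lightestKeptAt v) ≈ 0# ⊎ Saturated M v
      complementary (yes saturated) = inj₂ saturated
      complementary (no  _)         = inj₁ refl

theorem2 : ∀ {c ℓ₁ ℓ₂} (R : OrderedCommRing c ℓ₁ ℓ₂) →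
    let open OrderedCommRing R in
    (n m : ℕ) (edge : Fin m → Subset n) → Injective _≡_ _≡_ edge →
    (w : Fin m → Carrier) → (∀ j → 0# ≤ w j) →
    (∀ i j → i Fin.≤ j → w j ≤ w i) →
    (b : Fin n → ℕ) → (∀ v → 1 ℕ.≤ b v) →
    (x : Fin m → Carrier) → IsFracBMatching R edge b x →
    IsBMatching edge b (greedy edge b) ×
    (sum (λ j → x j * w j) ≤ greedyValue R edge (greedy edge b) w x)
theorem2 R n m edge _ w w-nonNeg w-antitone b _ x fractional =
  GreedyInvariant.greedy-isBMatching edge b ,
  WeakDuality.fractionalValue≤greedyValue R edge b (greedy edge b) w
    (GreedyCertificate.potential-certificate R edge b w w-nonNeg w-antitone) x fractional
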